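{- Let $\mathbb{F}$ be a field, let $U \in \mathbb{F}^{n\times m}$ with $n \le m$ have full row rank $n$, and let $\Omega \subsetneq [n]$. Let $S\subseteq[m]$ be an $\Omega$-valid set with $\mathrm{rank}(U_{:,S})=n-1$, and let $D\subseteq[m]$ be an $\Omega$-valid set with $S\subseteq D$. Then $D\subseteq E(S)$.
   Context: For $S\subseteq[m]$, $U_{:,S}$ denotes the submatrix of $U$ with columns indexed by $S$. For $\lambda\in\mathbb{F}^n$, $\mathrm{supp}(\lambda)=\{i:\lambda_i\neq 0\}$. A set $S\subseteq[m]$ is $\Omega$-valid if there exists $\lambda\in\mathbb{F}^n$ with $\mathrm{supp}(\lambda)\not\subseteq\Omega$ and $\lambda^T U_{:,S}=0$. The extension $E(S)$ of $S\subseteq[m]$ is the largest set $E\subseteq[m]$ such that the column span of $U_{:,S}$ equals the column span of $U_{:,E}$. -}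

module Defs where

open import Level using (Level; _⊔_; suc)
open import Algebra.Bundles using (CommutativeRing)
open import Data.Nat using (ℕ)
open import Data.Fin using (Fin)
open import Data.Fin.Subset using (Subset; _∈_; _∉_; _⊆_)
open import Data.Product using (Σ; ∃; _×_)
open import Relation.Nullary using (¬_)
open import Function.Definitions using (Injective)
open import Relation.Binary.PropositionalEquality using (_≡_)

record Field (c ℓ : Level) : Set (suc (c ⊔ ℓ)) where
  field
    commutativeRing : CommutativeRing c ℓ
  open CommutativeRing commutativeRing public
  field
    0≉1     : ¬ (0# ≈ 1#)
    inverse : ∀ x → ¬ (x ≈ 0#) → ∃ λ y → (x * y) ≈ 1#

module LinAlg {c ℓ : Level} (F : Field c ℓ) where
  open Field F
  open import Algebra.Definitions.RawMonoid +-rawMonoid using (sum) public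

  Vec' : ℕ → Set c
  Vec' n = Fin n → Carrier

  Matrix : ℕ → ℕ → Set c
  Matrix n m = Fin n → Fin m → Carrier

  col : ∀ {n m} → Matrix n m → Fin m → Vec' n
  col U j i = U i j

  InColSpan : ∀ {n m} → Matrix n m → Subset m → Vec' n → Set (c ⊔ ℓ)
  InColSpan {n} {m} U S v =
    Σ (Fin m → Carrier) λ co →
      (∀ j → j ∉ S → co j ≈ 0#) ×
      (∀ i → v i ≈ sum (λ j → co j * U i j))

  InSpan : ∀ {n r} → (Fin r → Vec' n) → Vec' n → Set (c ⊔ ℓ)
  InSpan {n} {r} b v =
    Σ (Fin r → Carrier) λ co → ∀ i → v i ≈ sum (λ k → co k * b k i)

  LinIndep : ∀ {n r} → (Fin r → Vec' n) → Set (c ⊔ ℓ)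
  LinIndep {n} {r} b =
    ∀ (co : Fin r → Carrier) →
      (∀ i → sum (λ k → co k * b k i) ≈ 0#) → ∀ k → co k ≈ 0#

  HasRank : ∀ {n m} → Matrix n m → Subset m → ℕ → Set (c ⊔ ℓ)
  HasRank {n} {m} U S r =
    Σ (Fin r → Vec' n) λ b →
      (∀ k → InColSpan U S (b k)) ×
      LinIndep b ×
      (∀ v → InColSpan U S v → InSpan b v)

  ColSpanSub : ∀ {n m} → Matrix n m → Subset m → Subset m → Set (c ⊔ ℓ)
  ColSpanSub {n} U S T = ∀ (v : Vec' n) → InColSpan U S v → InColSpan U T v

  ColSpanEq : ∀ {n m} → Matrix n m → Subset m → Subset m → Set (c ⊔ ℓ)
  ColSpanEq U S T = ColSpanSub U S T × ColSpanSub U T S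

  IsExtension : ∀ {n m} → Matrix n m → Subset m → Subset m → Set (c ⊔ ℓ)
  IsExtension {n} {m} U S E =
    ColSpanEq U S E × (∀ (E' : Subset m) → ColSpanEq U S E' → E' ⊆ E)

  IsValid : ∀ {n m} → Matrix n m → Subset n → Subset m → Set (c ⊔ ℓ)
  IsValid {n} {m} U Ω S =
    Σ (Fin n → Carrier) λ lam →
      (∃ λ i → ¬ (lam i ≈ 0#) × i ∉ Ω) ×
      (∀ j → j ∈ S → sum (λ i → lam i * U i j) ≈ 0#)

module Submission where

-- Let μ witness that D is Ω-valid: μ ≠ 0 and μᵀ U_{:,j} = 0
-- for every j ∈ D.  If rank U_{:,S} = n-1, a basis b₁,…,b_{n-1} of colspan U_{:,S}
-- lies in colspan U_{:,D} ⊆ μ^⊥, a hyperplane of dimension n-1; hence b spans μ^⊥.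
-- Every column of D lies in μ^⊥, so colspan U_{:,D} = colspan U_{:,S}, and D ⊆ E(S)
-- by maximality of the extension.
--
-- Equality in an abstract field is not decidable, so the dimension count "n vectors
-- in an (n-1)-dimensional space are dependent" only holds under a double negation;
-- since membership in E is decidable, that is enough.

open import Defs
open import Level using (Level; _⊔_)
open import Data.Nat using (ℕ; _≤_; _∸_; zero; suc)
open import Data.Fin using (Fin; zero; suc; punchIn; punchOut)
open import Data.Fin.Properties using (punchIn-punchOut; ∀-cons; all?; ¬∀⟶∃¬)
  renaming (_≟_ to _≟ᶠ_)
open import Data.Fin.Subset using (Subset; _⊆_; _∈_; _∉_; ⊤)
open import Data.Fin.Subset.Properties using (_∈?_)
open import Data.Product using (Σ; ∃; _×_; _,_; proj₁; proj₂)
open import Data.Sum using (_⊎_; inj₁; inj₂)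
open import Data.Vec.Functional using (_∷_; insertAt)
open import Data.Vec.Functional.Properties using (insertAt-lookup; insertAt-punchIn)
open import Function using (_∘_)
open import Relation.Nullary using (¬_; Dec; yes; no)
open import Relation.Nullary.Negation using (DoubleNegation; ¬¬-map; contradiction)
open import Relation.Nullary.Decidable using (¬¬-excluded-middle; decidable-stable)
import Relation.Binary.PropositionalEquality as ≡

infixl 1 _>>=¬¬_
_>>=¬¬_ : ∀ {a b} {A : Set a} {B : Set b} →
  DoubleNegation A → (A → DoubleNegation B) → DoubleNegation B
(¬¬a >>=¬¬ f) ¬b = ¬¬a (λ a → f a ¬b)

¬¬-∀ : ∀ {r a} {Q : Fin r → Set a} →
  (∀ j → DoubleNegation (Q j)) → DoubleNegation (∀ j → Q j)
¬¬-∀ {zero}  h ¬∀ = ¬∀ (λ ())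
¬¬-∀ {suc r} h =
  h zero >>=¬¬ λ q₀ → ¬¬-∀ (h ∘ suc) >>=¬¬ λ qₛ ¬∀ → ¬∀ (∀-cons q₀ qₛ)

module HyperplaneRank {c ℓ : Level} (F : Field c ℓ) where
  open Field F hiding (zero)
  open LinAlg F
  open import Algebra.Properties.Semiring.Sum semiring
    using (sum-cong-≋; sum-replicate-zero; sum-remove; ∑-comm; ∑-distrib-+;
           *-distribˡ-sum; *-distribʳ-sum)
  open import Algebra.Properties.Ring ring
    using (-‿distribˡ-*; -‿distribʳ-*; +-inverseˡ-unique)
  open import Relation.Binary.Reasoning.Setoid setoid

  inverse-cancel : ∀ {a d} → a * d ≈ 1# → ∀ b → b ≈ d * (a * b)
  inverse-cancel {a} {d} ad≈1 b = begin
    b           ≈⟨ *-identityˡ b ⟨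
    1# * b      ≈⟨ *-cong (trans (sym ad≈1) (*-comm a d)) refl ⟩
    d * a * b   ≈⟨ *-assoc d a b ⟩
    d * (a * b) ∎

  cancel-nonzero : ∀ {a b} → ¬ (a ≈ 0#) → a * b ≈ 0# → b ≈ 0#
  cancel-nonzero {a} {b} a≉0 ab≈0 with inverse a a≉0
  ... | d , ad≈1 = trans (inverse-cancel ad≈1 b) (trans (*-cong refl ab≈0) (zeroʳ d))

  solve-linear : ∀ {a d x t} → a * d ≈ 1# → a * x + t ≈ 0# → x ≈ (- d) * t
  solve-linear {a} {d} {x} {t} ad≈1 eq = begin
    x           ≈⟨ inverse-cancel ad≈1 x ⟩
    d * (a * x) ≈⟨ *-cong refl (+-inverseˡ-unique (a * x) t eq) ⟩
    d * - t     ≈⟨ -‿distribʳ-* d t ⟨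
    - (d * t)   ≈⟨ -‿distribˡ-* d t ⟩
    (- d) * t   ∎

  ¬¬-nonzero-or-zero : ∀ {r} (f : Fin r → Carrier) →
    DoubleNegation ((∃ λ p → ¬ (f p ≈ 0#)) ⊎ (∀ p → f p ≈ 0#))
  ¬¬-nonzero-or-zero {r} f = ¬¬-map classify (¬¬-∀ (λ j → ¬¬-excluded-middle))
    where
    classify : (∀ j → Dec (f j ≈ 0#)) → (∃ λ p → ¬ (f p ≈ 0#)) ⊎ (∀ p → f p ≈ 0#)
    classify zero? with all? zero?
    ... | yes all-zero = inj₂ all-zero
    ... | no ¬all-zero = inj₁ (¬∀⟶∃¬ r _ zero? ¬all-zero)

  sum-zero : ∀ {r} (f : Fin r → Carrier) → (∀ j → f j ≈ 0#) → sum f ≈ 0#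
  sum-zero {r} f f≈0 = trans (sum-cong-≋ f≈0) (sum-replicate-zero r)

  lincomb : ∀ {r n} → (Fin r → Carrier) → (Fin r → Vec' n) → Vec' n
  lincomb co X i = sum (λ k → co k * X k i)

  _·_ : ∀ {n} → Vec' n → Vec' n → Carrier
  μ · x = sum (λ i → μ i * x i)

  ·-lincomb : ∀ {r n} (μ : Vec' n) (co : Fin r → Carrier) (X : Fin r → Vec' n) →
    μ · lincomb co X ≈ sum (λ k → co k * (μ · X k))
  ·-lincomb μ co X = begin
    sum (λ i → μ i * sum (λ k → co k * X k i))
      ≈⟨ sum-cong-≋ (λ i → *-distribˡ-sum (μ i) (λ k → co k * X k i)) ⟩
    sum (λ i → sum (λ k → μ i * (co k * X k i)))
      ≈⟨ ∑-comm (λ i k → μ i * (co k * X k i)) ⟩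
    sum (λ k → sum (λ i → μ i * (co k * X k i)))
      ≈⟨ sum-cong-≋ (λ k → sum-cong-≋ (λ i → x∙yz≈y∙xz (μ i) (co k) (X k i))) ⟩
    sum (λ k → sum (λ i → co k * (μ i * X k i)))
      ≈⟨ sum-cong-≋ (λ k → *-distribˡ-sum (co k) (λ i → μ i * X k i)) ⟨
    sum (λ k → co k * (μ · X k)) ∎
    where
    x∙yz≈y∙xz : ∀ x y z → x * (y * z) ≈ y * (x * z)
    x∙yz≈y∙xz x y z = trans (sym (*-assoc x y z))
                        (trans (*-cong (*-comm x y) refl) (*-assoc y x z))

  NontrivialRelation : ∀ {r n} → (Fin r → Vec' n) → Set (c ⊔ ℓ)
  NontrivialRelation {r} w =
    Σ (Fin r → Carrier) λ co → (∀ i → lincomb co w i ≈ 0#) × ∃ λ j → ¬ (co j ≈ 0#)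

  relation-from-zero-row : ∀ {r k} (w : Fin (suc r) → Vec' (suc k)) →
    (∀ j → w j zero ≈ 0#) →
    NontrivialRelation (λ j i → w (suc j) (suc i)) → NontrivialRelation w
  relation-from-zero-row w first≈0 (co , rel , j , coⱼ≉0) =
    (0# ∷ co) , relation , suc j , coⱼ≉0
    where
    drop-w₀ : ∀ i → lincomb (0# ∷ co) w i ≈ lincomb co (w ∘ suc) i
    drop-w₀ i = trans (+-cong (zeroˡ (w zero i)) refl) (+-identityˡ _)
    relation : ∀ i → lincomb (0# ∷ co) w i ≈ 0#
    relation zero    = trans (drop-w₀ zero)
      (sum-zero _ (λ j → trans (*-cong refl (first≈0 (suc j))) (zeroʳ (co j))))
    relation (suc i) = trans (drop-w₀ (suc i)) (rel i)

  -- Gaussian elimination with pivot p (w_p(0) y = 1): the vectors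
  -- cleared j = w_{pj} - w_{pj}(0) y w_p have first coordinate 0, and a relation
  -- among them lifts to a relation of w by giving w_p a suitable coefficient.
  -- (pj ranges over the indices other than p, via punchIn.)
  module Elimination {r k} (w : Fin (suc r) → Vec' (suc k))
                     (p : Fin (suc r)) (y : Carrier) (pivot : w p zero * y ≈ 1#) where

    factor : Fin r → Carrier
    factor j = - (w (punchIn p j) zero * y)

    cleared : Fin r → Vec' (suc k)
    cleared j i = w (punchIn p j) i + factor j * w p i

    cleared-zero : ∀ j → cleared j zero ≈ 0#
    cleared-zero j = begin
      a + - (a * y) * w p zero ≈⟨ +-cong refl (-‿distribˡ-* (a * y) (w p zero)) ⟨
      a + - (a * y * w p zero) ≈⟨ +-cong refl (-‿cong a*y*w≈a) ⟩
      a + - a                  ≈⟨ -‿inverseʳ a ⟩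
      0#                       ∎
      where
      a : Carrier
      a = w (punchIn p j) zero
      a*y*w≈a : a * y * w p zero ≈ a
      a*y*w≈a = trans (*-assoc a y (w p zero))
        (trans (*-cong refl (trans (*-comm y (w p zero)) pivot)) (*-identityʳ a))

    lift : (Fin r → Carrier) → Fin (suc r) → Carrier
    lift co = insertAt co p (sum (λ j → co j * factor j))

    lincomb-lift : ∀ co i → lincomb (lift co) w i ≈ lincomb co cleared i
    lincomb-lift co i = begin
      lincomb (lift co) w i
        ≈⟨ sum-remove {i = p} (λ J → lift co J * w J i) ⟩
      lift co p * w p i + sum (λ j → lift co (punchIn p j) * w (punchIn p j) i)
        ≈⟨ +-cong (*-cong (reflexive (insertAt-lookup co p s)) refl)
                  (sum-cong-≋ (λ j → *-cong (reflexive (insertAt-punchIn co p s j)) refl)) ⟩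
      s * w p i + sum (λ j → co j * w (punchIn p j) i)
        ≈⟨ +-comm _ _ ⟩
      sum (λ j → co j * w (punchIn p j) i) + s * w p i
        ≈⟨ +-cong refl (*-distribʳ-sum (w p i) (λ j → co j * factor j)) ⟩
      sum (λ j → co j * w (punchIn p j) i) + sum (λ j → co j * factor j * w p i)
        ≈⟨ ∑-distrib-+ (λ j → co j * w (punchIn p j) i) (λ j → co j * factor j * w p i) ⟨
      sum (λ j → co j * w (punchIn p j) i + co j * factor j * w p i)
        ≈⟨ sum-cong-≋ (λ j → trans (+-cong refl (*-assoc (co j) (factor j) (w p i)))
                                   (sym (distribˡ (co j) _ _))) ⟩
      lincomb co cleared i ∎
      where
      s : Carrier
      s = sum (λ j → co j * factor j)

    -- the first coordinate of Σⱼ coⱼ clearedⱼ vanishes automatically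
    relation-lifts : NontrivialRelation (λ j i → cleared j (suc i)) → NontrivialRelation w
    relation-lifts (co , rel , j , coⱼ≉0) =
      lift co , (λ i → trans (lincomb-lift co i) (relation i)) , punchIn p j ,
      ≡.subst (λ t → ¬ (t ≈ 0#)) (≡.sym (insertAt-punchIn co p _ j)) coⱼ≉0
      where
      relation : ∀ i → lincomb co cleared i ≈ 0#
      relation zero    = sum-zero _ (λ j → trans (*-cong refl (cleared-zero j)) (zeroʳ (co j)))
      relation (suc i) = rel i

  -- Induction on k: either the first coordinates all vanish, or one of them is a
  -- pivot for elimination; both reduce to k vectors in F^(k-1).
  dependent : ∀ k (w : Fin (suc k) → Vec' k) → DoubleNegation (NontrivialRelation w)
  dependent zero w ¬rel = ¬rel ((λ _ → 1#) , (λ ()) , zero , λ 1≈0 → 0≉1 (sym 1≈0))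
  dependent (suc k) w = ¬¬-nonzero-or-zero (λ j → w j zero) >>=¬¬ by-first-column
    where
    by-first-column : (∃ λ p → ¬ (w p zero ≈ 0#)) ⊎ (∀ p → w p zero ≈ 0#) →
      DoubleNegation (NontrivialRelation w)
    by-first-column (inj₁ (p , pivot≉0)) with inverse (w p zero) pivot≉0
    ... | y , pivot = ¬¬-map relation-lifts (dependent k (λ j i → cleared j (suc i)))
      where open Elimination w p y pivot
    by-first-column (inj₂ first≈0) =
      ¬¬-map (relation-from-zero-row w first≈0) (dependent k (λ j i → w (suc j) (suc i)))

  orthogonal-vanishes : ∀ {N} (μ z : Vec' (suc N)) (p : Fin (suc N)) → ¬ (μ p ≈ 0#) →
    μ · z ≈ 0# → (∀ i → z (punchIn p i) ≈ 0#) → ∀ i → z i ≈ 0#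
  orthogonal-vanishes μ z p μₚ≉0 μz≈0 off-p≈0 i with p ≟ᶠ i
  ... | yes ≡.refl = cancel-nonzero μₚ≉0 (begin
    μ p * z p                                     ≈⟨ +-identityʳ _ ⟨
    μ p * z p + 0#                                ≈⟨ +-cong refl (sum-zero _ off-terms) ⟨
    μ p * z p + sum (λ i → μ (punchIn p i) * z (punchIn p i)) ≈⟨ sum-remove {i = p} (λ i → μ i * z i) ⟨
    μ · z                                         ≈⟨ μz≈0 ⟩
    0#                                            ∎)
    where
    off-terms : ∀ i → μ (punchIn p i) * z (punchIn p i) ≈ 0#
    off-terms i = trans (*-cong refl (off-p≈0 i)) (zeroʳ _)
  ... | no p≢i = ≡.subst (λ t → z t ≈ 0#) (punchIn-punchOut p≢i) (off-p≈0 (punchOut p≢i))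

  -- Deleting a coordinate p with μ_p ≠ 0 is injective on μ^⊥, so a relation of
  -- vectors in μ^⊥ may be checked with that coordinate deleted.
  relation-in-hyperplane : ∀ {r N} (μ : Vec' (suc N)) (p : Fin (suc N)) → ¬ (μ p ≈ 0#) →
    (z : Fin r → Vec' (suc N)) → (∀ k → μ · z k ≈ 0#) →
    NontrivialRelation (λ k i → z k (punchIn p i)) → NontrivialRelation z
  relation-in-hyperplane μ p μₚ≉0 z orth (co , rel , nontrivial) =
    co , orthogonal-vanishes μ (lincomb co z) p μₚ≉0 μ·comb≈0 rel , nontrivial
    where
    μ·comb≈0 : μ · lincomb co z ≈ 0#
    μ·comb≈0 = trans (·-lincomb μ co z)
      (sum-zero _ (λ k → trans (*-cong refl (orth k)) (zeroʳ (co k))))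

  -- If b is independent, a nontrivial relation among x, b₁,…,b_N must involve x
  -- with a nonzero coefficient, so x lies in the span of b.
  relation-to-span : ∀ {N n} (x : Vec' n) (b : Fin N → Vec' n) → LinIndep b →
    NontrivialRelation (x ∷ b) → InSpan b x
  relation-to-span x b indep (co , rel , j , coⱼ≉0) with inverse (co zero) co₀≉0
    where
    co₀≉0 : ¬ (co zero ≈ 0#)
    co₀≉0 co₀≈0 = coⱼ≉0 (all-zero j)
      where
      b-relation : ∀ i → lincomb (co ∘ suc) b i ≈ 0#
      b-relation i = trans (sym (+-identityˡ _))
        (trans (+-cong (sym (trans (*-cong co₀≈0 refl) (zeroˡ (x i)))) refl) (rel i))
      all-zero : ∀ k → co k ≈ 0#
      all-zero zero    = co₀≈0
      all-zero (suc k) = indep (co ∘ suc) b-relation k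
  ... | d , co₀d≈1 = (λ k → (- d) * co (suc k)) , λ i → begin
    x i                                    ≈⟨ solve-linear co₀d≈1 (rel i) ⟩
    (- d) * lincomb (co ∘ suc) b i         ≈⟨ *-distribˡ-sum (- d) (λ k → co (suc k) * b k i) ⟩
    sum (λ k → (- d) * (co (suc k) * b k i)) ≈⟨ sum-cong-≋ (λ k → *-assoc (- d) (co (suc k)) (b k i)) ⟨
    sum (λ k → (- d) * co (suc k) * b k i) ∎

  hyperplane-spanned : ∀ {N} (μ : Vec' (suc N)) (p : Fin (suc N)) → ¬ (μ p ≈ 0#) →
    (b : Fin N → Vec' (suc N)) → LinIndep b → (∀ k → μ · b k ≈ 0#) →
    (x : Vec' (suc N)) → μ · x ≈ 0# → DoubleNegation (InSpan b x)
  hyperplane-spanned {N} μ p μₚ≉0 b indep orth x μx≈0 =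
    ¬¬-map (relation-to-span x b indep ∘ relation-in-hyperplane μ p μₚ≉0 (x ∷ b) orth-x∷b)
           (dependent N (λ k i → (x ∷ b) k (punchIn p i)))
    where
    orth-x∷b : ∀ k → μ · (x ∷ b) k ≈ 0#
    orth-x∷b zero    = μx≈0
    orth-x∷b (suc k) = orth k

  colSpan-mono : ∀ {n m} (U : Matrix n m) {S T : Subset m} → S ⊆ T → ColSpanSub U S T
  colSpan-mono U S⊆T v (co , supp , v≈) = co , (λ j j∉T → supp j (j∉T ∘ S⊆T)) , v≈

  colSpan-scale : ∀ {n m} (U : Matrix n m) (S : Subset m) (a : Carrier) {x : Vec' n} →
    InColSpan U S x → InColSpan U S (λ i → a * x i)
  colSpan-scale U S a (co , supp , x≈) =
    (λ j → a * co j) , (λ j j∉S → trans (*-cong refl (supp j j∉S)) (zeroʳ a)) ,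
    λ i → trans (*-cong refl (x≈ i))
            (trans (*-distribˡ-sum a (λ j → co j * U i j))
                   (sum-cong-≋ (λ j → sym (*-assoc a (co j) (U i j)))))

  colSpan-zero : ∀ {n m} (U : Matrix n m) (S : Subset m) {x : Vec' n} →
    (∀ i → x i ≈ 0#) → InColSpan U S x
  colSpan-zero U S x≈0 = (λ _ → 0#) , (λ _ _ → refl) ,
    λ i → trans (x≈0 i) (sym (sum-zero _ (λ j → zeroˡ (U i j))))

  colSpan-lincomb : ∀ {n m r} (U : Matrix n m) (S : Subset m)
    (a : Fin r → Carrier) (X : Fin r → Vec' n) →
    (∀ k → InColSpan U S (λ i → a k * X k i)) →
    ∀ {v} → (∀ i → v i ≈ lincomb a X i) → InColSpan U S v
  colSpan-lincomb {r = r} U S a X term∈ {v} v≈ = co , supp , eq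
    where
    g : Fin r → Fin _ → Carrier
    g k = proj₁ (term∈ k)
    co : Fin _ → Carrier
    co j = sum (λ k → g k j)
    supp : ∀ j → j ∉ S → co j ≈ 0#
    supp j j∉S = sum-zero _ (λ k → proj₁ (proj₂ (term∈ k)) j j∉S)
    eq : ∀ i → v i ≈ sum (λ j → co j * U i j)
    eq i = begin
      v i                                    ≈⟨ v≈ i ⟩
      sum (λ k → a k * X k i)                ≈⟨ sum-cong-≋ (λ k → proj₂ (proj₂ (term∈ k)) i) ⟩
      sum (λ k → sum (λ j → g k j * U i j))  ≈⟨ ∑-comm (λ k j → g k j * U i j) ⟩
      sum (λ j → sum (λ k → g k j * U i j))  ≈⟨ sum-cong-≋ (λ j → *-distribʳ-sum (U i j) (λ k → g k j)) ⟨
      sum (λ j → co j * U i j)               ∎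

  annihilates-colSpan : ∀ {n m} (U : Matrix n m) {T : Subset m} (μ : Vec' n) →
    (∀ j → j ∈ T → μ · col U j ≈ 0#) → ∀ {v} → InColSpan U T v → μ · v ≈ 0#
  annihilates-colSpan U {T} μ ann {v} (co , supp , v≈) = begin
    μ · v                                   ≈⟨ sum-cong-≋ (λ i → *-cong refl (v≈ i)) ⟩
    μ · lincomb co (λ j i → U i j)          ≈⟨ ·-lincomb μ co (λ j i → U i j) ⟩
    sum (λ j → co j * (μ · col U j))        ≈⟨ sum-zero _ term≈0 ⟩
    0#                                      ∎
    where
    term≈0 : ∀ j → co j * (μ · col U j) ≈ 0#
    term≈0 j with j ∈? T
    ... | yes j∈T = trans (*-cong refl (ann j j∈T)) (zeroʳ (co j))
    ... | no j∉T  = trans (*-cong (supp j j∉T) refl) (zeroˡ _)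

  colSpan-collapse : ∀ {N m} (U : Matrix (suc N) m) (S D : Subset m) → HasRank U S N →
    (μ : Vec' (suc N)) → (∃ λ p → ¬ (μ p ≈ 0#)) → (∀ j → j ∈ D → μ · col U j ≈ 0#) →
    S ⊆ D → DoubleNegation (ColSpanSub U D S)
  colSpan-collapse U S D (b , b∈S , indep , _) μ (p , μₚ≉0) ann S⊆D =
    ¬¬-map columns-to-colSpan (¬¬-∀ column-in-span)
    where
    orth : ∀ k → μ · b k ≈ 0#
    orth k = annihilates-colSpan U μ ann (colSpan-mono U S⊆D (b k) (b∈S k))

    column-in-span : ∀ j → DoubleNegation (j ∈ D → InSpan b (col U j))
    column-in-span j with j ∈? D
    ... | yes j∈D = ¬¬-map (λ in-span _ → in-span)
                      (hyperplane-spanned μ p μₚ≉0 b indep orth (col U j) (ann j j∈D))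
    ... | no j∉D  = λ ¬claim → ¬claim (λ j∈D → contradiction j∈D j∉D)

    span⊆colSpan : ∀ {v} → InSpan b v → InColSpan U S v
    span⊆colSpan (a , v≈) = colSpan-lincomb U S a b (λ k → colSpan-scale U S (a k) (b∈S k)) v≈

    columns-to-colSpan : (∀ j → j ∈ D → InSpan b (col U j)) → ColSpanSub U D S
    columns-to-colSpan cols v (co , supp , v≈) = colSpan-lincomb U S co (λ j i → U i j) term∈ v≈
      where
      term∈ : ∀ j → InColSpan U S (λ i → co j * U i j)
      term∈ j with j ∈? D
      ... | yes j∈D = colSpan-scale U S (co j) (span⊆colSpan (cols j j∈D))
      ... | no j∉D  = colSpan-zero U S (λ i → trans (*-cong (supp j j∉D) refl) (zeroˡ _))

open HyperplaneRank using (colSpan-mono; colSpan-collapse)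

mainTheorem8 : ∀ {c ℓ : Level} (F : Field c ℓ) → let open LinAlg F in
    ∀ {n m : ℕ} (U : Matrix n m) → n ≤ m → HasRank U ⊤ n →
    ∀ (Ω : Subset n) → (∃ λ i → i ∉ Ω) →
    ∀ (S D : Subset m) → IsValid U Ω S → HasRank U S (n ∸ 1) →
    IsValid U Ω D → S ⊆ D →
    ∀ (E : Subset m) → IsExtension U S E → D ⊆ E
mainTheorem8 F {zero} U _ _ Ω _ S D _ _ (μ , ((() , _) , _)) _ E _ _
mainTheorem8 F {suc N} U _ _ Ω _ S D _ rank-S (μ , (p , μₚ≉0 , _) , ann) S⊆D E (_ , maximal) {j} j∈D =
  decidable-stable (j ∈? E)
    (¬¬-map (λ D⊆S → maximal D (colSpan-mono F U S⊆D , D⊆S) j∈D)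
            (colSpan-collapse F U S D rank-S μ (p , μₚ≉0) ann S⊆D))
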